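{- Let $G$ be a connected graph of order $n\ge 2$. Then every vertex of $G$ lies in a fort of cardinality two if and only if $\operatorname{Z}^*(G)=\frac n2$.
   Context: A fort of $G$ is a nonempty $F\subseteq V(G)$ such that every $v\in V(G)\setminus F$ has $|N_G(v)\cap F|\neq 1$; a minimal fort is one not properly containing another fort. $\operatorname{Z}^*(G)=\min\{\sum_{v\in V(G)}x_v : \sum_{v\in F}x_v\ge 1 \text{ for every minimal fort } F \text{ of } G,\ x_v\ge 0\}$.
   Formalization: The variables $x_v$ of the linear program defining $\operatorname{Z}^*(G)$ take rational values. -}

module Defs where

open import Data.Nat using (ℕ; zero; suc)
open import Data.Bool using (Bool; true; false; if_then_else_)
open import Data.Fin using (Fin; zero; suc)
open import Data.Fin.Subset using (Subset; _∈_; _∉_; _⊆_; _∩_; ∣_∣; Nonempty)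
open import Data.Vec using (tabulate)
open import Data.Rational using (ℚ; 0ℚ; 1ℚ; _+_; _≤_)
open import Data.Product using (Σ; _×_; _,_; ∃)
open import Relation.Binary.PropositionalEquality using (_≡_; _≢_)

record Graph (n : ℕ) : Set where
  field
    adj   : Fin n → Fin n → Bool
    sym   : ∀ u v → adj u v ≡ adj v u
    loopless : ∀ v → adj v v ≡ false
open Graph public

data Walk {n : ℕ} (G : Graph n) : Fin n → Fin n → Set where
  here : ∀ {u} → Walk G u u
  step : ∀ {u w v} → adj G u w ≡ true → Walk G w v → Walk G u v

Connected : ∀ {n} → Graph n → Set
Connected {n} G = ∀ (u v : Fin n) → Walk G u v

N : ∀ {n} → Graph n → Fin n → Subset n
N G v = tabulate (λ u → adj G v u)

IsFort : ∀ {n} → Graph n → Subset n → Set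
IsFort {n} G F = Nonempty F × (∀ (v : Fin n) → v ∉ F → ∣ N G v ∩ F ∣ ≢ 1)

IsMinimalFort : ∀ {n} → Graph n → Subset n → Set
IsMinimalFort {n} G F = IsFort G F × (∀ (F' : Subset n) → IsFort G F' → F' ⊆ F → F ⊆ F')

Σℚ : ∀ {n} → (Fin n → ℚ) → ℚ
Σℚ {zero}  f = 0ℚ
Σℚ {suc n} f = f zero + Σℚ (λ i → f (suc i))

ΣOver : ∀ {n} → Subset n → (Fin n → ℚ) → ℚ
ΣOver F x = Σℚ (λ i → if Data.Vec.lookup F i then x i else 0ℚ)

-- Feasible points of the fractional zero forcing LP.
Feasible : ∀ {n} → Graph n → (Fin n → ℚ) → Set
Feasible {n} G x = (∀ v → 0ℚ ≤ x v) × (∀ (F : Subset n) → IsMinimalFort G F → 1ℚ ≤ ΣOver F x)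

ZStarIs : ∀ {n} → Graph n → ℚ → Set
ZStarIs G q = (Σ _ λ x → Feasible G x × Σℚ x ≡ q) × (∀ x → Feasible G x → q ≤ Σℚ x)

InFortOfSize2 : ∀ {n} → Graph n → Fin n → Set
InFortOfSize2 {n} G v = Σ (Subset n) λ F → IsFort G F × ∣ F ∣ ≡ 2 × v ∈ F

-- A two-element set {u, w} is a fort exactly when u and w are twins, i.e. have the same neighbours outside
-- {u, w}; as no vertex is isolated there are no one-element forts, so such a pair is a minimal fort.
-- Every fort thus has two vertices and the constant weight ½ is feasible, giving Z*(G) ≤ n/2.
-- If every vertex has a twin, a feasible weight puts at least 1 on every twin pair. A vertex of weight
-- below ½ has a twin of weight above ½, and no two such light vertices share a twin (twinship is
-- transitive), so removing light vertices together with their twins one pair at a time shows that the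
-- total weight is at least n/2. If some v has no twin, every fort contains two vertices other than v, so
-- the weight ½ with x_v lowered to 0 is still feasible and Z*(G) < n/2.

module Submission where

open import Data.Nat as ℕ using (ℕ; zero; suc; z≤n; s≤s)
open import Data.Integer using (ℤ; +_)
import Data.Integer as ℤ
open import Data.Integer.Tactic.RingSolver using (solve-∀)
open import Data.Bool using (true; false; if_then_else_)
import Data.Bool.Properties as Bool
open import Data.Fin using (Fin; zero; suc; _≟_)
open import Data.Fin.Properties using (any?; all?)
open import Data.Fin.Subset using (Subset; _∈_; _∉_; _⊆_; _⊂_; _∩_; _∪_; _─_; _-_; ⁅_⁆; ⊥; ⊤; ∣_∣; Empty)
open import Data.Fin.Subset.Properties
  using (x∈⁅x⁆; x∈⁅y⁆⇒x≡y; x∈p∪q⁺; x∈p∪q⁻; x∈p∩q⁺; x∈p∩q⁻; x∈p∧x≢y⇒x∈p-y; p─q⊆p; p─⊥≡p;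
         ⊆-antisym; ∪-comm; Empty-unique; ∣⊥∣≡0; ∣⁅x⁆∣≡1; ∈⊤; nonempty?; _∈?_)
open import Data.Fin.Subset.Induction using (⊂-wellFounded)
open import Induction.WellFounded using (WfRec; module All)
open import Data.Vec.Base using ([]; _∷_; here; there)
open import Data.Vec.Properties using ([]=⇒lookup; lookup⇒[]=; lookup∘tabulate)
open import Data.Rational using (ℚ; 0ℚ; 1ℚ; ½; _+_; _≤_; _<_; _/_; toℚᵘ)
open import Data.Rational.Properties
  using (≤-refl; ≤-reflexive; +-mono-≤; +-monoʳ-≤; +-mono-<; +-monoˡ-<; <-irrefl; <-≤-trans; ≮⇒≥; _<?_; +-identityˡ; +-identityʳ; +-assoc;
         +-0-commutativeMonoid; nonNegative⁻¹; positive⁻¹; toℚᵘ-injective; toℚᵘ-homo-+; toℚᵘ-fromℚᵘ; module ≤-Reasoning)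
import Data.Rational.Unnormalised as ℚᵘ
open import Data.Rational.Unnormalised.Properties using (module ≃-Reasoning; +-congʳ)
open import Algebra.Bundles using (module CommutativeMonoid)
open CommutativeMonoid +-0-commutativeMonoid using (commutativeSemigroup)
open import Algebra.Properties.CommutativeSemigroup commutativeSemigroup using (x∙yz≈y∙xz)
open import Data.Empty using (⊥-elim)
open import Data.Nat.Properties using (suc-injective)
open import Data.Product using (_×_; _,_; proj₁; proj₂; ∃-syntax)
open import Data.Sum using (_⊎_; inj₁; inj₂; [_,_])
open import Relation.Nullary using (¬_; Dec; yes; no; does; contradiction)
open import Relation.Nullary.Decidable using (_×-dec_; _→-dec_; ¬?; dec-true; dec-false)
open import Relation.Binary.PropositionalEquality
  using (_≡_; _≢_; refl; sym; trans; cong; subst; ≢-sym; module ≡-Reasoning)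

open import Defs renaming (sym to adj-sym)

private variable
  n : ℕ
  p F : Subset n
  u v w x y z : Fin n

-- Finite subsets

x∉p-x : ∀ (p : Subset n) x → x ∉ p - x
x∉p-x (_ ∷ p) (suc x) (there x∈p-x) = x∉p-x p x x∈p-x

x∈p-y⁻ : x ∈ p - y → x ∈ p × x ≢ y
x∈p-y⁻ {p = p} {y = y} x∈p-y = p─q⊆p p ⁅ y ⁆ x∈p-y , λ { refl → x∉p-x p y x∈p-y }

∣p∣≡1+∣p-x∣ : x ∈ p → ∣ p ∣ ≡ suc ∣ p - x ∣
∣p∣≡1+∣p-x∣ {p = _ ∷ p} here = cong (λ q → suc ∣ q ∣) (sym (p─⊥≡p p))
∣p∣≡1+∣p-x∣ {p = true  ∷ _} (there x∈p) = cong suc (∣p∣≡1+∣p-x∣ x∈p)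
∣p∣≡1+∣p-x∣ {p = false ∷ _} (there x∈p) = ∣p∣≡1+∣p-x∣ x∈p

∣p∣≡2+∣p-u-w∣ : u ∈ p → w ∈ p → u ≢ w → ∣ p ∣ ≡ suc (suc ∣ p - u - w ∣)
∣p∣≡2+∣p-u-w∣ u∈p w∈p u≢w =
  trans (∣p∣≡1+∣p-x∣ u∈p) (cong suc (∣p∣≡1+∣p-x∣ (x∈p∧x≢y⇒x∈p-y w∈p (≢-sym u≢w))))

∣p∣≡0⇒Empty : ∣ p ∣ ≡ 0 → Empty p
∣p∣≡0⇒Empty ∣p∣≡0 (x , x∈p) with () ← trans (sym ∣p∣≡0) (∣p∣≡1+∣p-x∣ x∈p)

Empty⇒∣p∣≡0 : ∀ {n} {p : Subset n} → Empty p → ∣ p ∣ ≡ 0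
Empty⇒∣p∣≡0 {n} empty = trans (cong ∣_∣ (Empty-unique empty)) (∣⊥∣≡0 n)

∣p∣≡1⇒x≡y : ∣ p ∣ ≡ 1 → x ∈ p → y ∈ p → x ≡ y
∣p∣≡1⇒x≡y {x = x} {y = y} ∣p∣≡1 x∈p y∈p with x ≟ y
... | yes x≡y = x≡y
... | no x≢y with () ← trans (sym ∣p∣≡1) (∣p∣≡2+∣p-u-w∣ x∈p y∈p x≢y)

p⊆⁅x⁆⇒∣p∣≡1 : x ∈ p → p ⊆ ⁅ x ⁆ → ∣ p ∣ ≡ 1
p⊆⁅x⁆⇒∣p∣≡1 {x = x} {p = p} x∈p p⊆⁅x⁆ = trans (cong ∣_∣ p≡⁅x⁆) (∣⁅x⁆∣≡1 x)
  where
  p≡⁅x⁆ : p ≡ ⁅ x ⁆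
  p≡⁅x⁆ = ⊆-antisym p⊆⁅x⁆ λ y∈⁅x⁆ → subst (_∈ p) (sym (x∈⁅y⁆⇒x≡y x y∈⁅x⁆)) x∈p

Empty[p-x]⇒p⊆⁅x⁆ : Empty (p - x) → p ⊆ ⁅ x ⁆
Empty[p-x]⇒p⊆⁅x⁆ {x = x} empty {y} y∈p with y ≟ x
... | yes refl = x∈⁅x⁆ x
... | no y≢x   = ⊥-elim (empty (y , x∈p∧x≢y⇒x∈p-y y∈p y≢x))

pair : Fin n → Fin n → Subset n
pair u w = ⁅ u ⁆ ∪ ⁅ w ⁆

u∈pair : u ∈ pair u w
u∈pair {u = u} = x∈p∪q⁺ (inj₁ (x∈⁅x⁆ u))

w∈pair : w ∈ pair u w
w∈pair {w = w} = x∈p∪q⁺ (inj₂ (x∈⁅x⁆ w))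

∈pair⁻ : x ∈ pair u w → x ≡ u ⊎ x ≡ w
∈pair⁻ {u = u} {w} x∈pair with x∈p∪q⁻ ⁅ u ⁆ ⁅ w ⁆ x∈pair
... | inj₁ x∈⁅u⁆ = inj₁ (x∈⁅y⁆⇒x≡y u x∈⁅u⁆)
... | inj₂ x∈⁅w⁆ = inj₂ (x∈⁅y⁆⇒x≡y w x∈⁅w⁆)

∉pair : x ≢ u → x ≢ w → x ∉ pair u w
∉pair x≢u x≢w x∈pair = [ x≢u , x≢w ] (∈pair⁻ x∈pair)

pair⊆ : u ∈ p → w ∈ p → pair u w ⊆ p
pair⊆ {p = p} u∈p w∈p x∈pair = [ (λ { refl → u∈p }) , (λ { refl → w∈p }) ] (∈pair⁻ x∈pair)

pair-u-w≡⊥ : pair u w - u - w ≡ ⊥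
pair-u-w≡⊥ = Empty-unique λ (x , x∈) →
  let x∈pair-u , x≢w = x∈p-y⁻ x∈
      x∈pair , x≢u = x∈p-y⁻ x∈pair-u
  in ∉pair x≢u x≢w x∈pair

Empty[p-u-w]⇒p⊆pair : Empty (p - u - w) → p ⊆ pair u w
Empty[p-u-w]⇒p⊆pair {u = u} {w = w} empty {x} x∈p with x ≟ u | x ≟ w
... | yes refl | _        = u∈pair
... | no _     | yes refl = w∈pair
... | no x≢u   | no x≢w   = ⊥-elim (empty (x , x∈p∧x≢y⇒x∈p-y (x∈p∧x≢y⇒x∈p-y x∈p x≢u) x≢w))

∣pair∣≡2 : ∀ {n} {u w : Fin n} → u ≢ w → ∣ pair u w ∣ ≡ 2
∣pair∣≡2 {n = n} {u = u} {w} u≢w = begin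
  ∣ pair u w ∣                       ≡⟨ ∣p∣≡2+∣p-u-w∣ u∈pair w∈pair u≢w ⟩
  suc (suc ∣ pair u w - u - w ∣)   ≡⟨ cong (λ q → suc (suc ∣ q ∣)) (pair-u-w≡⊥ {u = u} {w}) ⟩
  suc (suc ∣ ⊥ {n = n} ∣)          ≡⟨ cong (λ k → suc (suc k)) (∣⊥∣≡0 n) ⟩
  2                                 ∎
  where open ≡-Reasoning

∣p∣≡2⇒p≡pair : ∣ p ∣ ≡ 2 → u ∈ p → w ∈ p → u ≢ w → p ≡ pair u w
∣p∣≡2⇒p≡pair ∣p∣≡2 u∈p w∈p u≢w = ⊆-antisym (Empty[p-u-w]⇒p⊆pair empty) (pair⊆ u∈p w∈p)
  where
  empty = ∣p∣≡0⇒Empty (suc-injective (suc-injective (trans (sym (∣p∣≡2+∣p-u-w∣ u∈p w∈p u≢w)) ∣p∣≡2)))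

-- Sums of weights over subsets

ΣOver-remove : ∀ (f : Fin n → ℚ) → x ∈ p → ΣOver p f ≡ f x + ΣOver (p - x) f
ΣOver-remove {p = _ ∷ p} f here = cong (λ q → f zero + q) (sym (begin
  0ℚ + ΣOver (p ─ ⊥) (λ i → f (suc i))   ≡⟨ +-identityˡ _ ⟩
  ΣOver (p ─ ⊥) (λ i → f (suc i))        ≡⟨ cong (λ q → ΣOver q (λ i → f (suc i))) (p─⊥≡p p) ⟩
  ΣOver p (λ i → f (suc i))              ∎))
  where open ≡-Reasoning
ΣOver-remove {p = s ∷ p} f (there {i = x} x∈p) =
  trans (cong (λ q → c + q) (ΣOver-remove f′ x∈p)) (x∙yz≈y∙xz c (f′ x) (ΣOver (p - x) f′))
  where
  f′ = λ i → f (suc i)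
  c  = if s then f zero else 0ℚ

ΣOver-remove₂ : ∀ (f : Fin n → ℚ) → u ∈ p → w ∈ p → u ≢ w →
  ΣOver p f ≡ f u + f w + ΣOver (p - u - w) f
ΣOver-remove₂ {u = u} {p = p} {w = w} f u∈p w∈p u≢w = begin
  ΣOver p f                           ≡⟨ ΣOver-remove f u∈p ⟩
  f u + ΣOver (p - u) f               ≡⟨ cong (λ q → f u + q) (ΣOver-remove f (x∈p∧x≢y⇒x∈p-y w∈p (≢-sym u≢w))) ⟩
  f u + (f w + ΣOver (p - u - w) f)   ≡⟨ +-assoc (f u) (f w) _ ⟨
  f u + f w + ΣOver (p - u - w) f     ∎
  where open ≡-Reasoning

ΣOver-⊥ : ∀ {n} (f : Fin n → ℚ) → ΣOver ⊥ f ≡ 0ℚ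
ΣOver-⊥ {zero}  f = refl
ΣOver-⊥ {suc n} f = trans (+-identityˡ _) (ΣOver-⊥ (λ i → f (suc i)))

ΣOver-⊤ : ∀ {n} (f : Fin n → ℚ) → ΣOver ⊤ f ≡ Σℚ f
ΣOver-⊤ {zero}  f = refl
ΣOver-⊤ {suc n} f = cong (λ q → f zero + q) (ΣOver-⊤ (λ i → f (suc i)))

ΣOver-mono : ∀ (p : Subset n) {f g : Fin n → ℚ} → (∀ {i} → i ∈ p → f i ≤ g i) → ΣOver p f ≤ ΣOver p g
ΣOver-mono []          f≤g = ≤-refl
ΣOver-mono (true  ∷ p) f≤g = +-mono-≤ (f≤g here) (ΣOver-mono p (λ i∈p → f≤g (there i∈p)))
ΣOver-mono (false ∷ p) f≤g = +-monoʳ-≤ 0ℚ (ΣOver-mono p (λ i∈p → f≤g (there i∈p)))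

ΣOver-nonneg : ∀ (p : Subset n) {f : Fin n → ℚ} → (∀ i → 0ℚ ≤ f i) → 0ℚ ≤ ΣOver p f
ΣOver-nonneg []          0≤f = ≤-refl
ΣOver-nonneg (true  ∷ p) 0≤f = +-mono-≤ (0≤f zero) (ΣOver-nonneg p (λ i → 0≤f (suc i)))
ΣOver-nonneg (false ∷ p) 0≤f = +-mono-≤ ≤-refl (ΣOver-nonneg p (λ i → 0≤f (suc i)))

ΣOver-pair : ∀ (f : Fin n → ℚ) → u ≢ w → ΣOver (pair u w) f ≡ f u + f w
ΣOver-pair {u = u} {w = w} f u≢w = begin
  ΣOver (pair u w) f                       ≡⟨ ΣOver-remove₂ f u∈pair w∈pair u≢w ⟩
  f u + f w + ΣOver (pair u w - u - w) f   ≡⟨ cong (λ q → f u + f w + ΣOver q f) (pair-u-w≡⊥ {u = u} {w = w}) ⟩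
  f u + f w + ΣOver ⊥ f                    ≡⟨ cong (λ q → f u + f w + q) (ΣOver-⊥ f) ⟩
  f u + f w + 0ℚ                           ≡⟨ +-identityʳ _ ⟩
  f u + f w                                ∎
  where open ≡-Reasoning

two-halves⇒1≤ΣOver : ∀ (f : Fin n → ℚ) → (∀ i → 0ℚ ≤ f i) →
  u ∈ p → w ∈ p → u ≢ w → ½ ≤ f u → ½ ≤ f w → 1ℚ ≤ ΣOver p f
two-halves⇒1≤ΣOver {u = u} {p = p} {w = w} f 0≤f u∈p w∈p u≢w ½≤fu ½≤fw = begin
  1ℚ                              ≡⟨⟩
  ½ + ½ + 0ℚ                      ≤⟨ +-mono-≤ (+-mono-≤ ½≤fu ½≤fw) (ΣOver-nonneg (p - u - w) 0≤f) ⟩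
  f u + f w + ΣOver (p - u - w) f ≡⟨ ΣOver-remove₂ f u∈p w∈p u≢w ⟨
  ΣOver p f                       ∎
  where open ≤-Reasoning

½+n/2≡[1+n]/2 : ∀ n → ½ + (+ n) / 2 ≡ (+ suc n) / 2
½+n/2≡[1+n]/2 n = toℚᵘ-injective (begin
  toℚᵘ (½ + (+ n) / 2)                ≈⟨ toℚᵘ-homo-+ ½ ((+ n) / 2) ⟩
  toℚᵘ ½ ℚᵘ.+ toℚᵘ ((+ n) / 2)        ≈⟨ +-congʳ (toℚᵘ ½) (toℚᵘ-fromℚᵘ (ℚᵘ.mkℚᵘ (+ n) 1)) ⟩
  toℚᵘ ½ ℚᵘ.+ ℚᵘ.mkℚᵘ (+ n) 1         ≈⟨ ℚᵘ.*≡* (numerators (+ n)) ⟩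
  ℚᵘ.mkℚᵘ (+ suc n) 1                  ≈⟨ toℚᵘ-fromℚᵘ (ℚᵘ.mkℚᵘ (+ suc n) 1) ⟨
  toℚᵘ ((+ suc n) / 2)                 ∎)
  where
  open ≃-Reasoning
  numerators : ∀ (m : ℤ) → (ℤ.+ 1 ℤ.* ℤ.+ 2 ℤ.+ m ℤ.* ℤ.+ 2) ℤ.* ℤ.+ 2 ≡ (ℤ.+ 1 ℤ.+ m) ℤ.* (ℤ.+ 2 ℤ.* ℤ.+ 2)
  numerators = solve-∀

Σℚ-½≡n/2 : ∀ n → Σℚ {n} (λ _ → ½) ≡ (+ n) / 2
Σℚ-½≡n/2 zero    = refl
Σℚ-½≡n/2 (suc n) = trans (cong (λ q → ½ + q) (Σℚ-½≡n/2 n)) (½+n/2≡[1+n]/2 n)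

½-except : Fin n → Fin n → ℚ
½-except v i = if does (i ≟ v) then 0ℚ else ½

0≤½ : 0ℚ ≤ ½
0≤½ = nonNegative⁻¹ ½

½-except-nonneg : ∀ (v i : Fin n) → 0ℚ ≤ ½-except v i
½-except-nonneg v i with does (i ≟ v)
... | true  = ≤-refl
... | false = 0≤½

½-except-self : ∀ (v : Fin n) → ½-except v v ≡ 0ℚ
½-except-self v = cong (λ b → if b then 0ℚ else ½) (dec-true (v ≟ v) refl)

½-except-≢ : x ≢ v → ½-except v x ≡ ½
½-except-≢ {x = x} {v = v} x≢v = cong (λ b → if b then 0ℚ else ½) (dec-false (x ≟ v) x≢v)

Σℚ-½-except<n/2 : ∀ (v : Fin n) → Σℚ (½-except v) < (+ n) / 2
Σℚ-½-except<n/2 {n = n} v = begin-strict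
  Σℚ (½-except v)                              ≡⟨ ΣOver-⊤ (½-except v) ⟨
  ΣOver ⊤ (½-except v)                         ≡⟨ ΣOver-remove (½-except v) (∈⊤ {x = v}) ⟩
  ½-except v v + ΣOver (⊤ - v) (½-except v)    ≡⟨ cong (λ q → q + ΣOver (⊤ - v) (½-except v)) (½-except-self v) ⟩
  0ℚ + ΣOver (⊤ - v) (½-except v)              ≤⟨ +-monoʳ-≤ 0ℚ (ΣOver-mono (⊤ - v) λ i∈ → ≤-reflexive (½-except-≢ (proj₂ (x∈p-y⁻ i∈)))) ⟩
  0ℚ + ΣOver (⊤ - v) (λ _ → ½)                 <⟨ +-monoˡ-< (ΣOver (⊤ - v) (λ _ → ½)) (positive⁻¹ ½) ⟩
  ½ + ΣOver (⊤ - v) (λ _ → ½)                  ≡⟨ ΣOver-remove (λ _ → ½) (∈⊤ {x = v}) ⟨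
  ΣOver (⊤ {n}) (λ _ → ½)                      ≡⟨ ΣOver-⊤ {n} (λ _ → ½) ⟩
  Σℚ (λ (_ : Fin n) → ½)                       ≡⟨ Σℚ-½≡n/2 n ⟩
  (+ n) / 2                                    ∎
  where open ≤-Reasoning

module _ {n} (x : Fin n → ℚ) (R : Fin n → Fin n → Set)
         (R-weight : ∀ {u w} → R u w → 1ℚ ≤ x u + x w)
         (R-trans : ∀ {u v w} → R u w → R v w → u ≢ v → R u v) where

  private
    Light : Fin n → Set
    Light u = x u < ½

    light-unrelated : ∀ {u v} → Light u → Light v → ¬ R u v
    light-unrelated u-light v-light Ruv = <-irrefl refl (<-≤-trans (+-mono-< u-light v-light) (R-weight Ruv))

    LightHavePartnersIn : Subset n → Set
    LightHavePartnersIn S = ∀ {u} → u ∈ S → Light u → ∃[ w ] w ∈ S × R u w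

    halves≤weights : ∀ S → LightHavePartnersIn S → ΣOver S (λ _ → ½) ≤ ΣOver S x
    halves≤weights = All.wfRec ⊂-wellFounded _ _ peel-light-pair
      where
      peel-light-pair : ∀ S → WfRec _⊂_ (λ S → LightHavePartnersIn S → ΣOver S (λ _ → ½) ≤ ΣOver S x) S →
                        LightHavePartnersIn S → ΣOver S (λ _ → ½) ≤ ΣOver S x
      peel-light-pair S rec partners with any? (λ v → v ∈? S ×-dec x v <? ½)
      ... | no no-light = ΣOver-mono S λ {v} v∈S → ≮⇒≥ λ v-light → no-light (v , v∈S , v-light)
      ... | yes (v , v∈S , v-light) with partners v∈S v-light
      ...   | w , w∈S , Rvw = begin
        ΣOver S (λ _ → ½)                ≡⟨ ΣOver-remove₂ (λ _ → ½) v∈S w∈S v≢w ⟩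
        ½ + ½ + ΣOver S′ (λ _ → ½)       ≤⟨ +-mono-≤ (R-weight Rvw) (rec S′⊂S partners′) ⟩
        x v + x w + ΣOver S′ x           ≡⟨ ΣOver-remove₂ x v∈S w∈S v≢w ⟨
        ΣOver S x                        ∎
        where
        open ≤-Reasoning
        v≢w : v ≢ w
        v≢w refl = light-unrelated v-light v-light Rvw
        S′ = S - v - w
        S′⊂S : S′ ⊂ S
        S′⊂S = (λ u∈S′ → proj₁ (x∈p-y⁻ (proj₁ (x∈p-y⁻ u∈S′))))
             , v , v∈S , λ v∈S′ → proj₂ (x∈p-y⁻ (proj₁ (x∈p-y⁻ v∈S′))) refl
        partners′ : LightHavePartnersIn S′
        partners′ {u} u∈S′ u-light with x∈p-y⁻ u∈S′
        ... | u∈S-v , u≢w with x∈p-y⁻ u∈S-v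
        ...   | u∈S , u≢v with partners u∈S u-light
        ...     | t , t∈S , Rut = t , x∈p∧x≢y⇒x∈p-y (x∈p∧x≢y⇒x∈p-y t∈S t≢v) t≢w , Rut
          where
          t≢v : t ≢ v
          t≢v refl = light-unrelated u-light v-light Rut
          t≢w : t ≢ w
          t≢w refl = light-unrelated u-light v-light (R-trans Rut Rvw u≢v)

  n/2≤Σℚ : (∀ {u} → x u < ½ → ∃[ w ] R u w) → (+ n) / 2 ≤ Σℚ x
  n/2≤Σℚ partners = begin
    (+ n) / 2                 ≡⟨ Σℚ-½≡n/2 n ⟨
    Σℚ (λ (_ : Fin n) → ½)    ≡⟨ ΣOver-⊤ {n} (λ _ → ½) ⟨
    ΣOver (⊤ {n}) (λ _ → ½)   ≤⟨ halves≤weights ⊤ (λ _ u-light → let w , Ruw = partners u-light in w , ∈⊤ , Ruw) ⟩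
    ΣOver ⊤ x                 ≡⟨ ΣOver-⊤ x ⟩
    Σℚ x                      ∎
    where open ≤-Reasoning

-- Twins, forts of size two, and fractional zero forcing

HasNeighbour : Graph n → Fin n → Set
HasNeighbour G u = ∃[ z ] adj G u z ≡ true

Twins : Graph n → Fin n → Fin n → Set
Twins G u w = u ≢ w × (∀ z → z ≢ u → z ≢ w → adj G z u ≡ adj G z w)

module _ (G : Graph n) where

  ∈N⁻ : x ∈ N G z → adj G z x ≡ true
  ∈N⁻ {x = x} {z = z} x∈N = trans (sym (lookup∘tabulate (adj G z) x)) ([]=⇒lookup x∈N)

  ∈N⁺ : adj G z x ≡ true → x ∈ N G z
  ∈N⁺ {z = z} {x = x} zx = lookup⇒[]= x (N G z) (trans (lookup∘tabulate (adj G z) x) zx)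

  twins-trans : Twins G u w → Twins G v w → u ≢ v → Twins G u v
  twins-trans {u = u} {w = w} {v = v} (u≢w , u~w) (v≢w , v~w) u≢v = u≢v , agree
    where
    w-agrees : adj G w u ≡ adj G w v
    w-agrees = begin
      adj G w u   ≡⟨ adj-sym G w u ⟩
      adj G u w   ≡⟨ v~w u u≢v u≢w ⟨
      adj G u v   ≡⟨ adj-sym G u v ⟩
      adj G v u   ≡⟨ u~w v (≢-sym u≢v) v≢w ⟩
      adj G v w   ≡⟨ adj-sym G v w ⟩
      adj G w v   ∎
      where open ≡-Reasoning
    agree : ∀ z → z ≢ u → z ≢ v → adj G z u ≡ adj G z v
    agree z z≢u z≢v with z ≟ w
    ... | yes refl = w-agrees
    ... | no z≢w   = trans (u~w z z≢u z≢w) (sym (v~w z z≢v z≢w))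

  twins? : ∀ u w → Dec (Twins G u w)
  twins? u w = ¬? (u ≟ w) ×-dec all? λ z → ¬? (z ≟ u) →-dec ¬? (z ≟ w) →-dec adj G z u Bool.≟ adj G z w

  ∣N∩pair∣≡1 : adj G z u ≡ true → adj G z w ≡ false → ∣ N G z ∩ pair u w ∣ ≡ 1
  ∣N∩pair∣≡1 {z = z} {u = u} {w = w} zu zw = p⊆⁅x⁆⇒∣p∣≡1 (x∈p∩q⁺ (∈N⁺ zu , u∈pair)) only-u
    where
    only-u : N G z ∩ pair u w ⊆ ⁅ u ⁆
    only-u x∈ with x∈p∩q⁻ (N G z) (pair u w) x∈
    ... | x∈N , x∈pair with ∈pair⁻ x∈pair
    ...   | inj₁ refl = x∈⁅x⁆ u
    ...   | inj₂ refl = contradiction (trans (sym (∈N⁻ x∈N)) zw) λ ()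

  N∩pair-empty : adj G z u ≡ false → adj G z w ≡ false → Empty (N G z ∩ pair u w)
  N∩pair-empty {z = z} {u = u} {w = w} zu zw (x , x∈) with x∈p∩q⁻ (N G z) (pair u w) x∈
  ... | x∈N , x∈pair with ∈pair⁻ x∈pair
  ...   | inj₁ refl = contradiction (trans (sym (∈N⁻ x∈N)) zu) λ ()
  ...   | inj₂ refl = contradiction (trans (sym (∈N⁻ x∈N)) zw) λ ()

  fort-pair⇒twins : u ≢ w → IsFort G (pair u w) → Twins G u w
  fort-pair⇒twins {u = u} {w = w} u≢w (_ , fort) = u≢w , λ z z≢u z≢w → agree z (fort z (∉pair z≢u z≢w))
    where
    agree : ∀ z → ∣ N G z ∩ pair u w ∣ ≢ 1 → adj G z u ≡ adj G z w
    agree z ≢1 with adj G z u in zu | adj G z w in zw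
    ... | true  | true  = refl
    ... | false | false = refl
    ... | true  | false = contradiction (∣N∩pair∣≡1 zu zw) ≢1
    ... | false | true  =
      contradiction (subst (λ p → ∣ N G z ∩ p ∣ ≡ 1) (∪-comm ⁅ w ⁆ ⁅ u ⁆) (∣N∩pair∣≡1 zw zu)) ≢1

  twins⇒fort-pair : Twins G u w → IsFort G (pair u w)
  twins⇒fort-pair {u = u} {w = w} (u≢w , u~w) = (u , u∈pair) , λ z z∉pair →
    not-one z (u~w z (λ { refl → z∉pair u∈pair }) (λ { refl → z∉pair w∈pair }))
    where
    not-one : ∀ z → adj G z u ≡ adj G z w → ∣ N G z ∩ pair u w ∣ ≢ 1
    not-one z agree ∣∣≡1 with adj G z u in zu
    ... | true  = u≢w (∣p∣≡1⇒x≡y ∣∣≡1 (x∈p∩q⁺ (∈N⁺ zu , u∈pair)) (x∈p∩q⁺ (∈N⁺ (sym agree) , w∈pair)))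
    ... | false with () ← trans (sym (Empty⇒∣p∣≡0 (N∩pair-empty zu (sym agree)))) ∣∣≡1

  module _ (neighbours : ∀ u → HasNeighbour G u) where

    fort-∃-other-member : IsFort G F → u ∈ F → ∃[ w ] w ∈ F × w ≢ u
    fort-∃-other-member {F = F} {u = u} (_ , fort) u∈F with nonempty? (F - u) | neighbours u
    ... | yes (w , w∈F-u) | _      = w , x∈p-y⁻ w∈F-u
    ... | no F-u-empty    | z , uz = contradiction ∣N∩F∣≡1 (fort z z∉F)
      where
      F⊆⁅u⁆ : F ⊆ ⁅ u ⁆
      F⊆⁅u⁆ = Empty[p-x]⇒p⊆⁅x⁆ F-u-empty
      z∉F : z ∉ F
      z∉F z∈F with refl ← x∈⁅y⁆⇒x≡y u (F⊆⁅u⁆ z∈F) = contradiction (trans (sym uz) (loopless G u)) λ ()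
      ∣N∩F∣≡1 : ∣ N G z ∩ F ∣ ≡ 1
      ∣N∩F∣≡1 = p⊆⁅x⁆⇒∣p∣≡1 (x∈p∩q⁺ (∈N⁺ (trans (adj-sym G z u) uz) , u∈F))
                            (λ i∈ → F⊆⁅u⁆ (proj₂ (x∈p∩q⁻ (N G z) F i∈)))

    twins⇒minimal-fort-pair : Twins G u w → IsMinimalFort G (pair u w)
    twins⇒minimal-fort-pair {u = u} {w = w} twins = twins⇒fort-pair twins , minimal
      where
      minimal : ∀ F → IsFort G F → F ⊆ pair u w → pair u w ⊆ F
      minimal F fort F⊆pair with proj₁ fort
      ... | i , i∈F with fort-∃-other-member fort i∈F
      ...   | j , j∈F , j≢i with ∈pair⁻ (F⊆pair i∈F) | ∈pair⁻ (F⊆pair j∈F)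
      ...     | inj₁ refl | inj₂ refl = pair⊆ i∈F j∈F
      ...     | inj₂ refl | inj₁ refl = pair⊆ j∈F i∈F
      ...     | inj₁ refl | inj₁ refl = contradiction refl j≢i
      ...     | inj₂ refl | inj₂ refl = contradiction refl j≢i

    ½-feasible : Feasible G (λ _ → ½)
    ½-feasible = (λ _ → 0≤½) , λ F (fort , _) →
      let i , i∈F = proj₁ fort ; j , j∈F , j≢i = fort-∃-other-member fort i∈F in
      two-halves⇒1≤ΣOver (λ _ → ½) (λ _ → 0≤½) i∈F j∈F (≢-sym j≢i) ≤-refl ≤-refl

    twins-weight : ∀ {x : Fin n → ℚ} → Feasible G x → Twins G u w → 1ℚ ≤ x u + x w
    twins-weight {x = x} (_ , covered) twins =
      subst (1ℚ ≤_) (ΣOver-pair x (proj₁ twins)) (covered _ (twins⇒minimal-fort-pair twins))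

    size-two-fort⇒twin : IsFort G F → ∣ F ∣ ≡ 2 → u ∈ F → ∃[ w ] Twins G u w
    size-two-fort⇒twin fort ∣F∣≡2 u∈F with fort-∃-other-member fort u∈F
    ... | w , w∈F , w≢u = w , fort-pair⇒twins (≢-sym w≢u) (subst (IsFort G) F≡pair fort)
      where F≡pair = ∣p∣≡2⇒p≡pair ∣F∣≡2 u∈F w∈F (≢-sym w≢u)

    twinless⇒½-except-feasible : ¬ (∃[ w ] Twins G v w) → Feasible G (½-except v)
    twinless⇒½-except-feasible {v = v} twinless = ½-except-nonneg v , λ F (fort , _) → covered F fort
      where
      heavy : ∀ i → i ≢ v → ½ ≤ ½-except v i
      heavy _ i≢v = ≤-reflexive (sym (½-except-≢ i≢v))
      covered : ∀ F → IsFort G F → 1ℚ ≤ ΣOver F (½-except v)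
      covered F fort with v ∈? F
      ... | no v∉F = let (i , i∈F) = proj₁ fort ; j , j∈F , j≢i = fort-∃-other-member fort i∈F in
        two-halves⇒1≤ΣOver _ (½-except-nonneg v) i∈F j∈F (≢-sym j≢i)
          (heavy i λ { refl → v∉F i∈F }) (heavy j λ { refl → v∉F j∈F })
      ... | yes v∈F with fort-∃-other-member fort v∈F
      ...   | w , w∈F , w≢v with nonempty? (F - v - w)
      ...     | no empty = contradiction (w , fort-pair⇒twins (≢-sym w≢v) (subst (IsFort G) F≡pair fort)) twinless
        where F≡pair = ⊆-antisym (Empty[p-u-w]⇒p⊆pair empty) (pair⊆ v∈F w∈F)
      ...     | yes (i , i∈F-v-w) = let i∈F-v , i≢w = x∈p-y⁻ i∈F-v-w ; i∈F , i≢v = x∈p-y⁻ i∈F-v in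
        two-halves⇒1≤ΣOver _ (½-except-nonneg v) w∈F i∈F (≢-sym i≢w) (heavy w w≢v) (heavy i i≢v)

    size-two-forts⇒ZStarIs-n/2 : (∀ u → InFortOfSize2 G u) → ZStarIs G ((+ n) / 2)
    size-two-forts⇒ZStarIs-n/2 size-two-forts = ((λ _ → ½) , ½-feasible , Σℚ-½≡n/2 n) , λ x feasible →
      n/2≤Σℚ x (Twins G) (twins-weight feasible) twins-trans λ {u} _ →
        let F , fort , ∣F∣≡2 , u∈F = size-two-forts u in size-two-fort⇒twin fort ∣F∣≡2 u∈F

    ZStarIs-n/2⇒twins : ZStarIs G ((+ n) / 2) → ∀ v → ∃[ w ] Twins G v w
    ZStarIs-n/2⇒twins (_ , minimal) v with any? (twins? v)
    ... | yes twin     = twin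
    ... | no  twinless = ⊥-elim (<-irrefl refl
      (<-≤-trans (Σℚ-½-except<n/2 v) (minimal (½-except v) (twinless⇒½-except-feasible twinless))))

  twin⇒size-two-fort : Twins G u w → InFortOfSize2 G u
  twin⇒size-two-fort twins = pair _ _ , twins⇒fort-pair twins , ∣pair∣≡2 (proj₁ twins) , u∈pair

walk⇒neighbour : ∀ {G : Graph n} → Walk G u v → u ≢ v → HasNeighbour G u
walk⇒neighbour here                 u≢u = contradiction refl u≢u
walk⇒neighbour (step {w = w} uw _) _   = w , uw

connected⇒neighbours : ∀ {G : Graph n} → 2 ℕ.≤ n → Connected G → ∀ u → HasNeighbour G u
connected⇒neighbours (s≤s (s≤s z≤n)) connected zero    = walk⇒neighbour (connected zero (suc zero)) λ ()
connected⇒neighbours (s≤s (s≤s z≤n)) connected (suc u) = walk⇒neighbour (connected (suc u) zero) λ ()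

proposition3p17 : (n : ℕ) → 2 ℕ.≤ n → (G : Graph n) → Connected G →
    ((∀ v → InFortOfSize2 G v) → ZStarIs G ((+ n) / 2)) × (ZStarIs G ((+ n) / 2) → ∀ v → InFortOfSize2 G v)
proposition3p17 n 2≤n G connected =
    size-two-forts⇒ZStarIs-n/2 G neighbours
  , λ zstar v → twin⇒size-two-fort G (proj₂ (ZStarIs-n/2⇒twins G neighbours zstar v))
  where neighbours = connected⇒neighbours 2≤n connected
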